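{- Let $n\ge3$, let $\mathcal{I}\subseteq\{2,\ldots,n-1\}$ (so $1\notin\mathcal{I}$), let $\Gamma$ be the pregraph $2_{\mathcal{I}}^n$ with vertices $u,v$, and let $G$, $z,y_2,\ldots,y_{n-1}$ and $\zeta:D(\Gamma)\to G$ be as follows: $G$ is a group with distinct non-trivial generators $z,y_2,\ldots,y_{n-1}$ such that $y_i^2=1_G$; for $i\in\{3,\ldots,n-1\}$, $y_i^{ -1}zy_i=z$ if $i\in\mathcal{I}$ and $y_i^{ -1}zy_i=z^{ -1}$ if $i\notin\mathcal{I}$; $y_iy_j=y_jy_i$ whenever $|i-j|>1$; and $\zeta(u_0)=1_G$, $\zeta(u_1)=z$, $\zeta(u_i)=\zeta(v_i)=y_i$ for $i\ge2$. Let $R$ be the colour-preserving automorphism of $\Gamma$ interchanging its two vertices. If no automorphism of $G$ inverts $z$ while fixing $y_i$ for every $i\in\{2,\ldots,n-1\}$, then $R$ does not lift to an automorphism of $\mathrm{Cov}(\Gamma,\zeta)$, i.e. there is no automorphism $\tilde R$ of $\mathrm{Cov}(\Gamma,\zeta)$ with $\wp\circ\tilde R=R\circ\wp$, where $\wp$ is the projection $(x,a)\mapsto x$.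
   Context: A pregraph is a tuple $(V,D;\mathrm{beg},\mathrm{inv})$ with disjoint finite sets $V$ and $D$ (darts), a map $\mathrm{beg}:D\to V$ and an involution $\mathrm{inv}:D\to D$; an automorphism is a permutation of $V\cup D$ preserving $V$ and $D$ and commuting with $\mathrm{beg}$ and $\mathrm{inv}$. For $\mathcal{I}\subseteq\{0,\ldots,n-1\}$, $2_{\mathcal{I}}^n$ is the coloured pregraph with two vertices $u,v$ and, for each colour $i$, one dart $u_i$ starting at $u$ and one dart $v_i$ starting at $v$, both of colour $i$, with $\mathrm{inv}(u_i)=u_i$, $\mathrm{inv}(v_i)=v_i$ if $i\in\mathcal{I}$ and $\mathrm{inv}(u_i)=v_i$ otherwise; $R$ maps $u\mapsto v$, $u_i\mapsto v_i$ and vice versa. A voltage assignment satisfies $\zeta(\mathrm{inv}\,x)=\zeta(x)^{ -1}$. $\mathrm{Cov}(\Gamma,\zeta)$ has darts $D\times G$, vertices $V\times G$, $\mathrm{beg}(x,a)=(\mathrm{beg}\,x,a)$, $\mathrm{inv}(x,a)=(\mathrm{inv}\,x,\zeta(x)a)$, and projection $\wp(x,a)=x$, $\wp(w,a)=w$. -}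

module Defs where

open import Level using (Level; _⊔_) renaming (suc to lsuc; zero to lzero)
open import Data.Bool using (Bool; true; false; if_then_else_)
open import Data.Fin using (Fin; zero; suc; toℕ)
open import Data.Product using (_×_; _,_; proj₁; proj₂; Σ)
open import Data.Nat using (ℕ; _≤_; s≤s; z≤n)
open import Function.Bundles using (_↔_; Inverse)
open import Relation.Binary.PropositionalEquality
open import Algebra.Bundles using (Group)
open import Algebra.Structures using (IsGroup)
import Algebra.Properties.Group as GP

record Pregraph (ℓ : Level) : Set (lsuc ℓ) where
  field
    V : Set ℓ
    D : Set ℓ
    beg : D → V
    inv : D → D
    inv-involutive : ∀ d → inv (inv d) ≡ d

-- An automorphism: a permutation of V ∪ D preserving V and D
-- (i.e. a bijection of V and a bijection of D) commuting with beg and inv.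
record Automorphism {ℓ} (P : Pregraph ℓ) : Set ℓ where
  open Pregraph P
  field
    autV : V ↔ V
    autD : D ↔ D
  fV : V → V
  fV = Inverse.to autV
  fD : D → D
  fD = Inverse.to autD
  field
    beg-comm : ∀ d → beg (fD d) ≡ fV (beg d)
    inv-comm : ∀ d → inv (fD d) ≡ fD (inv d)

module _ {ℓ} {A : Set ℓ} (_∙_ : A → A → A) (ε : A) (_⁻¹ : A → A) where

  IsVoltage : ∀ {k} (P : Pregraph k) → (Pregraph.D P → A) → Set (ℓ ⊔ k)
  IsVoltage P ζ = ∀ x → ζ (Pregraph.inv P x) ≡ (ζ x) ⁻¹

  data Generated {k} (S : A → Set k) : A → Set (ℓ ⊔ k) where
    gen  : ∀ {a} → S a → Generated S a
    unit : Generated S ε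
    mul  : ∀ {a b} → Generated S a → Generated S b → Generated S (a ∙ b)
    inv  : ∀ {a} → Generated S a → Generated S (a ⁻¹)

  record GroupAutomorphism : Set ℓ where
    field
      bij : A ↔ A
    φ : A → A
    φ = Inverse.to bij
    field
      hom : ∀ a b → φ (a ∙ b) ≡ φ a ∙ φ b

module _ {ℓ} {A : Set ℓ} {_∙_ : A → A → A} {ε : A} {_⁻¹ : A → A}
         (isGroup : IsGroup _≡_ _∙_ ε _⁻¹) where

  private
    Grp : Group ℓ ℓ
    Grp = record { isGroup = isGroup }
    open IsGroup isGroup using (assoc; identityˡ; inverseˡ)

  Cov : ∀ {k} (P : Pregraph k) (ζ : Pregraph.D P → A) →
        IsVoltage _∙_ ε _⁻¹ P ζ → Pregraph (k ⊔ ℓ)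
  Cov P ζ volt = record
    { V = Pregraph.V P × A
    ; D = Pregraph.D P × A
    ; beg = λ { (x , a) → (Pregraph.beg P x , a) }
    ; inv = λ { (x , a) → (Pregraph.inv P x , ζ x ∙ a) }
    ; inv-involutive = λ { (x , a) → cong₂ _,_ (Pregraph.inv-involutive P x)
        (trans (sym (assoc _ _ _))
        (trans (cong (λ g → (g ∙ ζ x) ∙ a) (volt x))
        (trans (cong (_∙ a) (inverseˡ (ζ x))) (identityˡ a)))) }
    }

  -- projection ℘ : Cov(Γ,ζ) → Γ  is  (x , a) ↦ x  (i.e. proj₁), on vertices and darts.

data Vtx : Set where
  u v : Vtx

swapV : Vtx → Vtx
swapV u = v
swapV v = u

swapV-invol : ∀ w → swapV (swapV w) ≡ w
swapV-invol u = refl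
swapV-invol v = refl

-- The pregraph 2^n_I.  I : Fin n → Bool is the characteristic function of
-- the set of colours I.  Darts: u_i = (u , i), v_i = (v , i); colour of (w , i) is i.

inv2 : ∀ {n} → (Fin n → Bool) → Vtx × Fin n → Vtx × Fin n
inv2 I (w , i) = if I i then (w , i) else (swapV w , i)

inv2-invol : ∀ {n} (I : Fin n → Bool) d → inv2 I (inv2 I d) ≡ d
inv2-invol I (w , i) with I i in eq
... | true  rewrite eq = refl
... | false rewrite eq = cong (_, i) (swapV-invol w)

Two : (n : ℕ) → (Fin n → Bool) → Pregraph lzero
Two n I = record
  { V = Vtx
  ; D = Vtx × Fin n
  ; beg = proj₁
  ; inv = inv2 I
  ; inv-involutive = inv2-invol I
  }

R-V : Vtx → Vtx
R-V = swapV

R-D : ∀ {n} → Vtx × Fin n → Vtx × Fin n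
R-D (w , i) = (swapV w , i)

-- The voltage assignment ζ : ζ(u_0) = 1, ζ(u_1) = z, ζ(u_i) = ζ(v_i) = y_i (i ≥ 2);
-- the values ζ(v_0) = 1, ζ(v_1) = z⁻¹ are forced by the voltage condition,
-- since 0, 1 ∉ I.
module _ {ℓ} {A : Set ℓ} (_∙_ : A → A → A) (ε : A) (_⁻¹ : A → A) where

  zeta : ∀ {n} → A → (Fin n → A) → Vtx × Fin n → A
  zeta z y (u , zero)          = ε
  zeta z y (u , suc zero)      = z
  zeta z y (u , suc (suc k))   = y (suc (suc k))
  zeta z y (v , zero)          = ε
  zeta z y (v , suc zero)      = z ⁻¹
  zeta z y (v , suc (suc k))   = y (suc (suc k))

module _ {ℓ} {A : Set ℓ} {_∙_ : A → A → A} {ε : A} {_⁻¹ : A → A}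
         (isGroup : IsGroup _≡_ _∙_ ε _⁻¹) where

  private
    Grp : Group ℓ ℓ
    Grp = record { isGroup = isGroup }
    open GP Grp using (inverseʳ-unique; ε⁻¹≈ε; ⁻¹-involutive)

  zeta-voltage : ∀ {n} (I : Fin n → Bool) (z : A) (y : Fin n → A) →
    (∀ i → I i ≡ true → 2 ≤ toℕ i) →
    (∀ i → 2 ≤ toℕ i → y i ∙ y i ≡ ε) →
    IsVoltage _∙_ ε _⁻¹ (Two n I) (zeta _∙_ ε _⁻¹ z y)
  zeta-voltage I z y I⊆ y² (w , i) with I i in eq
  zeta-voltage I z y I⊆ y² (w , zero) | true with () ← I⊆ zero eq
  zeta-voltage I z y I⊆ y² (w , suc zero) | true with s≤s () ← I⊆ (suc zero) eq
  zeta-voltage I z y I⊆ y² (u , suc (suc k)) | true =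
    inverseʳ-unique _ _ (y² (suc (suc k)) (s≤s (s≤s z≤n)))
  zeta-voltage I z y I⊆ y² (v , suc (suc k)) | true =
    inverseʳ-unique _ _ (y² (suc (suc k)) (s≤s (s≤s z≤n)))
  zeta-voltage I z y I⊆ y² (u , zero) | false = sym ε⁻¹≈ε
  zeta-voltage I z y I⊆ y² (v , zero) | false = sym ε⁻¹≈ε
  zeta-voltage I z y I⊆ y² (u , suc zero) | false = refl
  zeta-voltage I z y I⊆ y² (v , suc zero) | false = sym (⁻¹-involutive z)
  zeta-voltage I z y I⊆ y² (u , suc (suc k)) | false =
    inverseʳ-unique _ _ (y² (suc (suc k)) (s≤s (s≤s z≤n)))
  zeta-voltage I z y I⊆ y² (v , suc (suc k)) | false =
    inverseʳ-unique _ _ (y² (suc (suc k)) (s≤s (s≤s z≤n)))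

  LiftsR : ∀ {n} (I : Fin n → Bool) (z : A) (y : Fin n → A) →
    (I⊆ : ∀ i → I i ≡ true → 2 ≤ toℕ i) →
    (y² : ∀ i → 2 ≤ toℕ i → y i ∙ y i ≡ ε) →
    Automorphism (Cov isGroup (Two n I) (zeta _∙_ ε _⁻¹ z y) (zeta-voltage I z y I⊆ y²)) →
    Set ℓ
  LiftsR I z y I⊆ y² R̃ =
    (∀ p → proj₁ (Automorphism.fV R̃ p) ≡ R-V (proj₁ p)) ×
    (∀ p → proj₁ (Automorphism.fD R̃ p) ≡ R-D (proj₁ p))

-- Write the vertex part of a lift R̃ as (w , a) ↦ (R w , g_w a). Compatibility of R̃
-- with inv on the darts of colour 0, whose voltage is trivial and which join u to v,
-- forces g_u = g_v =: g; on the darts of colour i it then says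
-- g (ζ(u_i) a) = ζ(v_i) g(a), i.e. g (z a) = z⁻¹ g(a) and g (y_i a) = y_i g(a).
-- The elements s admitting some t with g (s a) = t g(a) for all a form a subgroup,
-- hence all of G, and φ(s) = g(s) g(1)⁻¹ is an automorphism of G inverting z and
-- fixing every y_i.
module Submission where

open import Defs
open import Data.Bool using (Bool; true; false; if_then_else_)
open import Data.Nat using (ℕ; suc; _≤_; _<_; ∣_-_∣; s≤s)
open import Data.Fin using (Fin; toℕ; zero; suc)
open import Data.Product using (Σ; _×_; _,_; proj₁; proj₂)
open import Data.Sum using (_⊎_; inj₁; inj₂)
open import Function.Bundles using (Inverse; _↔_; mk↔ₛ′)
open import Function.Definitions using (Injective)
open import Relation.Nullary using (¬_)
open import Relation.Binary.PropositionalEquality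
open import Algebra.Bundles using (Group)
open import Algebra.Structures using (IsGroup)
import Algebra.Properties.Group as GroupProperties

swapV-injective : Injective _≡_ _≡_ swapV
swapV-injective {w} {w′} eq = trans (sym (swapV-invol w)) (trans (cong swapV eq) (swapV-invol w′))

inv2-∉ : ∀ {n} (I : Fin n → Bool) {w i} → I i ≡ false → inv2 I (w , i) ≡ (swapV w , i)
inv2-∉ I eq rewrite eq = refl

module _ {a b} {B : Set a} {A : Set b} (f : (B × A) ↔ (B × A)) (σ : B → B)
         (σ-injective : Injective _≡_ _≡_ σ)
         (f-over-σ : ∀ p → proj₁ (Inverse.to f p) ≡ σ (proj₁ p)) where

  open Inverse f

  fibre↔ : B → A ↔ A
  fibre↔ b₀ = mk↔ₛ′ (λ x → proj₂ (to (b₀ , x))) (λ x → proj₂ (from (σ b₀ , x))) to∘from from∘to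
    where
    to∘from : ∀ x → proj₂ (to (b₀ , proj₂ (from (σ b₀ , x)))) ≡ x
    to∘from x = cong proj₂ (trans (cong (λ b′ → to (b′ , proj₂ p)) (sym p-over-b₀)) (strictlyInverseˡ (σ b₀ , x)))
      where
      p : B × A
      p = from (σ b₀ , x)
      p-over-b₀ : proj₁ p ≡ b₀
      p-over-b₀ = σ-injective (trans (sym (f-over-σ p)) (cong proj₁ (strictlyInverseˡ (σ b₀ , x))))

    from∘to : ∀ x → proj₂ (from (σ b₀ , proj₂ (to (b₀ , x)))) ≡ x
    from∘to x = cong proj₂ (trans (cong (λ b′ → from (b′ , proj₂ (to (b₀ , x)))) (sym (f-over-σ (b₀ , x))))
                                  (strictlyInverseʳ (b₀ , x)))

module TwistedMaps {ℓ} {A : Set ℓ} {_∙_ : A → A → A} {ε : A} {_⁻¹ : A → A}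
                   (isGroup : IsGroup _≡_ _∙_ ε _⁻¹) (g↔ : A ↔ A) where

  open IsGroup isGroup using (assoc; identityˡ; _//_)
  open Inverse g↔ renaming (to to g; from to g⁻¹)

  private
    Grp : Group ℓ ℓ
    Grp = record { isGroup = isGroup }
  open GroupProperties Grp using (\\-leftDividesˡ; \\-leftDividesʳ; //-rightDividesˡ; //-rightDividesʳ)
  open ≡-Reasoning

  Twists : A → A → Set ℓ
  Twists s t = ∀ x → g (s ∙ x) ≡ t ∙ g x

  Twistable : A → Set ℓ
  Twistable s = Σ A (Twists s)

  twists-ε : Twists ε ε
  twists-ε x = trans (cong g (identityˡ x)) (sym (identityˡ (g x)))

  twists-∙ : ∀ {s s′ t t′} → Twists s t → Twists s′ t′ → Twists (s ∙ s′) (t ∙ t′)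
  twists-∙ {s} {s′} {t} {t′} T T′ x = begin
    g ((s ∙ s′) ∙ x)   ≡⟨ cong g (assoc s s′ x) ⟩
    g (s ∙ (s′ ∙ x))   ≡⟨ T (s′ ∙ x) ⟩
    t ∙ g (s′ ∙ x)     ≡⟨ cong (t ∙_) (T′ x) ⟩
    t ∙ (t′ ∙ g x)     ≡⟨ assoc t t′ (g x) ⟨
    (t ∙ t′) ∙ g x     ∎

  twists-⁻¹ : ∀ {s t} → Twists s t → Twists (s ⁻¹) (t ⁻¹)
  twists-⁻¹ {s} {t} T x = begin
    g ((s ⁻¹) ∙ x)                 ≡⟨ \\-leftDividesʳ t (g ((s ⁻¹) ∙ x)) ⟨
    (t ⁻¹) ∙ (t ∙ g ((s ⁻¹) ∙ x))  ≡⟨ cong ((t ⁻¹) ∙_) (T ((s ⁻¹) ∙ x)) ⟨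
    (t ⁻¹) ∙ g (s ∙ ((s ⁻¹) ∙ x))  ≡⟨ cong (λ x′ → (t ⁻¹) ∙ g x′) (\\-leftDividesˡ s x) ⟩
    (t ⁻¹) ∙ g x                   ∎

  twistable-generated : ∀ {k} {S : A → Set k} → (∀ {s} → S s → Twistable s) →
                        ∀ {s} → Generated _∙_ ε _⁻¹ S s → Twistable s
  twistable-generated gens (gen s∈S) = gens s∈S
  twistable-generated gens unit      = ε , twists-ε
  twistable-generated gens (mul p q) with twistable-generated gens p | twistable-generated gens q
  ... | t , T | t′ , T′ = t ∙ t′ , twists-∙ T T′
  twistable-generated gens (inv p) with twistable-generated gens p
  ... | t , T = (t ⁻¹) , twists-⁻¹ T

  twist : A → A
  twist s = g s // g ε

  twists⇒≡twist : ∀ {s t} → Twists s t → t ≡ twist s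
  twists⇒≡twist {s} {t} T = begin
    t                  ≡⟨ //-rightDividesʳ (g ε) t ⟨
    (t ∙ g ε) // g ε   ≡⟨ cong (_// g ε) (T ε) ⟨
    g (s ∙ ε) // g ε   ≡⟨ cong (λ x → g x // g ε) (IsGroup.identityʳ isGroup s) ⟩
    twist s            ∎

  twist-∙ : (∀ s → Twistable s) → ∀ s s′ → twist (s ∙ s′) ≡ twist s ∙ twist s′
  twist-∙ twistable s s′ with twistable s
  ... | t , T = begin
    g (s ∙ s′) // g ε        ≡⟨ cong (_// g ε) (T s′) ⟩
    (t ∙ g s′) // g ε        ≡⟨ assoc t (g s′) ((g ε) ⁻¹) ⟩
    t ∙ twist s′             ≡⟨ cong (_∙ twist s′) (twists⇒≡twist T) ⟩
    twist s ∙ twist s′       ∎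

  twist↔ : A ↔ A
  twist↔ = mk↔ₛ′ twist (λ x → g⁻¹ (x ∙ g ε))
    (λ x → trans (cong (_// g ε) (strictlyInverseˡ (x ∙ g ε))) (//-rightDividesʳ (g ε) x))
    (λ x → trans (cong g⁻¹ (//-rightDividesˡ (g ε) (g x))) (strictlyInverseʳ x))

  twist-automorphism : (∀ s → Twistable s) → GroupAutomorphism _∙_ ε _⁻¹
  twist-automorphism twistable = record { bij = twist↔ ; hom = twist-∙ twistable }

module LiftOfR {ℓ} {A : Set ℓ} {_∙_ : A → A → A} {ε : A} {_⁻¹ : A → A}
    (isGroup : IsGroup _≡_ _∙_ ε _⁻¹)
    {k : ℕ} (I : Fin (suc (suc k)) → Bool) (I⊆ : ∀ i → I i ≡ true → 2 ≤ toℕ i)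
    (z : A) (y : Fin (suc (suc k)) → A) (y² : ∀ i → 2 ≤ toℕ i → y i ∙ y i ≡ ε)
    (R̃ : Automorphism (Cov isGroup (Two (suc (suc k)) I) (zeta _∙_ ε _⁻¹ z y)
                           (zeta-voltage isGroup I z y I⊆ y²)))
    (R̃-lifts : LiftsR isGroup I z y I⊆ y² R̃) where

  open IsGroup isGroup using (identityˡ)
  open Automorphism R̃
  open ≡-Reasoning

  ζ : Vtx × Fin (suc (suc k)) → A
  ζ = zeta _∙_ ε _⁻¹ z y

  Γ̃ : Pregraph ℓ
  Γ̃ = Cov isGroup (Two (suc (suc k)) I) ζ (zeta-voltage isGroup I z y I⊆ y²)

  G : Vtx → A → A
  G w x = proj₂ (fV (w , x))

  open TwistedMaps isGroup (fibre↔ autV swapV swapV-injective (proj₁ R̃-lifts) u)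

  fD-fibre : ∀ d → proj₂ (fD d) ≡ G (proj₁ (proj₁ d)) (proj₂ d)
  fD-fibre d = cong proj₂ (beg-comm d)

  lift-dart : ∀ w i x → G (proj₁ (inv2 I (w , i))) (ζ (w , i) ∙ x) ≡ ζ (swapV w , i) ∙ G w x
  lift-dart w i x = begin
    G (proj₁ (inv2 I (w , i))) (ζ (w , i) ∙ x)  ≡⟨ fD-fibre (Pregraph.inv Γ̃ d) ⟨
    proj₂ (fD (Pregraph.inv Γ̃ d))               ≡⟨ cong proj₂ (inv-comm d) ⟨
    proj₂ (Pregraph.inv Γ̃ (fD d))               ≡⟨ cong (λ d′ → proj₂ (Pregraph.inv Γ̃ d′)) fD-d ⟩
    ζ (swapV w , i) ∙ G w x                      ∎
    where
    d : Pregraph.D Γ̃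
    d = (w , i) , x
    fD-d : fD d ≡ ((swapV w , i) , G w x)
    fD-d = cong₂ _,_ (proj₂ R̃-lifts d) (fD-fibre d)

  zero∉I : I zero ≡ false
  zero∉I with I zero in eq
  ... | true with () ← I⊆ zero eq
  ... | false = refl

  G-vertex-independent : ∀ w x → G w x ≡ G u x
  G-vertex-independent u x = refl
  G-vertex-independent v x = begin
    G v x                                             ≡⟨ cong (G v) (identityˡ x) ⟨
    G v (ε ∙ x)                                       ≡⟨ cong (λ d → G (proj₁ d) (ε ∙ x)) (inv2-∉ I zero∉I) ⟨
    G (proj₁ (inv2 I (u , zero))) (ζ (u , zero) ∙ x)  ≡⟨ lift-dart u zero x ⟩
    ε ∙ G u x                                         ≡⟨ identityˡ (G u x) ⟩
    G u x                                             ∎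

  dart-twists : ∀ w i → Twists (ζ (w , i)) (ζ (swapV w , i))
  dart-twists w i x = begin
    G u (ζ (w , i) ∙ x)                         ≡⟨ G-vertex-independent (proj₁ (inv2 I (w , i))) _ ⟨
    G (proj₁ (inv2 I (w , i))) (ζ (w , i) ∙ x)  ≡⟨ lift-dart w i x ⟩
    ζ (swapV w , i) ∙ G w x                     ≡⟨ cong (ζ (swapV w , i) ∙_) (G-vertex-independent w x) ⟩
    ζ (swapV w , i) ∙ G u x                     ∎

  y-twists : ∀ i → 2 ≤ toℕ i → Twists (y i) (y i)
  y-twists (suc zero) (s≤s ())
  y-twists (suc (suc j)) _ = dart-twists u (suc (suc j))

  lift⇒inverting-automorphism :
    (∀ s → Generated _∙_ ε _⁻¹ (λ g → g ≡ z ⊎ Σ (Fin (suc (suc k))) (λ i → 2 ≤ toℕ i × g ≡ y i)) s) →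
    Σ (GroupAutomorphism _∙_ ε _⁻¹) (λ φ →
      GroupAutomorphism.φ φ z ≡ (z ⁻¹) × (∀ i → 2 ≤ toℕ i → GroupAutomorphism.φ φ (y i) ≡ y i))
  lift⇒inverting-automorphism generated =
    twist-automorphism (λ s → twistable-generated generator-twistable (generated s)) ,
    sym (twists⇒≡twist (dart-twists u (suc zero))) ,
    λ i 2≤i → sym (twists⇒≡twist (y-twists i 2≤i))
    where
    generator-twistable : ∀ {s} → s ≡ z ⊎ Σ (Fin (suc (suc k))) (λ i → 2 ≤ toℕ i × s ≡ y i) → Twistable s
    generator-twistable (inj₁ refl)              = (z ⁻¹) , dart-twists u (suc zero)
    generator-twistable (inj₂ (i , 2≤i , refl)) = y i , y-twists i 2≤i

proposition16 : ∀ {ℓ} {A : Set ℓ} {_∙_ : A → A → A} {ε : A} {_⁻¹ : A → A}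
    (isGroup : IsGroup _≡_ _∙_ ε _⁻¹)
    (n : ℕ) → 3 ≤ n →
    (I : Fin n → Bool) (I⊆ : ∀ i → I i ≡ true → 2 ≤ toℕ i) →
    (z : A) (y : Fin n → A) →
    (∀ a → Generated _∙_ ε _⁻¹ (λ g → g ≡ z ⊎ Σ (Fin n) (λ i → 2 ≤ toℕ i × g ≡ y i)) a) →
    z ≢ ε →
    (∀ i → 2 ≤ toℕ i → y i ≢ ε) →
    (∀ i → 2 ≤ toℕ i → z ≢ y i) →
    (∀ i j → 2 ≤ toℕ i → 2 ≤ toℕ j → i ≢ j → y i ≢ y j) →
    (y² : ∀ i → 2 ≤ toℕ i → y i ∙ y i ≡ ε) →
    (∀ i → 3 ≤ toℕ i →
      (if I i then (((y i) ⁻¹) ∙ z) ∙ y i ≡ z else (((y i) ⁻¹) ∙ z) ∙ y i ≡ (z ⁻¹))) →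
    (∀ i j → 2 ≤ toℕ i → 2 ≤ toℕ j → 1 < ∣ toℕ i - toℕ j ∣ → y i ∙ y j ≡ y j ∙ y i) →
    ¬ (Σ (GroupAutomorphism _∙_ ε _⁻¹) (λ φ →
         GroupAutomorphism.φ φ z ≡ (z ⁻¹) ×
         (∀ i → 2 ≤ toℕ i → GroupAutomorphism.φ φ (y i) ≡ y i))) →
    ¬ (Σ (Automorphism (Cov isGroup (Two n I) (zeta _∙_ ε _⁻¹ z y) (zeta-voltage isGroup I z y I⊆ y²)))
         (LiftsR isGroup I z y I⊆ y²))
proposition16 isGroup _ (s≤s (s≤s _)) I I⊆ z y generated _ _ _ _ y² _ _ noInvertingAutomorphism (R̃ , R̃-lifts) =
  noInvertingAutomorphism (lift⇒inverting-automorphism generated)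
  where open LiftOfR isGroup I I⊆ z y y² R̃ R̃-lifts
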